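{- If $X\in\mathrm{IS}^0$ computes $\mathrm{PAR}_2$, then the length of $X$ is at least $6$.
   Context: Booleans are $\mathrm{F}$ and $\mathrm{T}$. An instruction sequence is a finite sequence $u_1;u_2;\dots;u_k$ of primitive instructions; its length is $k$. Basic instructions are: $\mathrm{in}{:}i.\mathrm{get}$ ($i\ge1$), $\mathrm{out}.\mathrm{set}{:}b$ ($b\in\{\mathrm{F},\mathrm{T}\}$), $\mathrm{aux}{:}i.\mathrm{get}$, $\mathrm{aux}{:}i.\mathrm{set}{:}b$, $\mathrm{aux}{:}i.\mathrm{com}$ ($i\ge1$). Each names a Boolean register ($\mathrm{in}{:}i$ input, $\mathrm{out}$ output, $\mathrm{aux}{:}i$ auxiliary) and a command: $\mathrm{get}$ leaves the register unchanged and replies its content; $\mathrm{set}{:}b$ sets the content to $b$ and replies $b$; $\mathrm{com}$ complements the content and replies the new content. Primitive instructions: for each basic instruction $a$, plain $a$, positive test ${+}a$, negative test ${ - }a$; forward jumps $\#l$ ($l\in\mathbb{N}$); termination $!$. Execution starts at $u_1$. ${+}a$ executes $a$ and proceeds with the next instruction if the reply is $\mathrm{T}$, otherwise skips the next instruction and proceeds with the one after; ${ - }a$ likewise with replies reversed; plain $a$ executes $a$ and proceeds with the next instruction; $\#l$ proceeds with the $l$th next instruction; $!$ terminates. If $l=0$ or there is no instruction to proceed with, inaction occurs (no termination). $X$ computes $f:\{\mathrm{F},\mathrm{T}\}^n\to\{\mathrm{F},\mathrm{T}\}$ if for all $b_1,\dots,b_n$: starting with $\mathrm{in}{:}i$ containing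 $b_i$ and $\mathrm{out}$ containing $\mathrm{F}$ (and any auxiliary registers used containing $\mathrm{F}$), execution terminates with $\mathrm{out}$ containing $f(b_1,\dots,b_n)$. $\mathrm{IS}^0$ is the set of instruction sequences in which no instruction involving any register $\mathrm{aux}{:}i$ occurs. $\mathrm{PAR}_2(b_1,b_2)=\mathrm{T}$ iff exactly one of $b_1,b_2$ is $\mathrm{T}$. -}

module Defs where

open import Data.Bool using (Bool; true; false; not; if_then_else_)
open import Data.Nat using (ℕ; zero; suc; _+_; _≡ᵇ_)
open import Data.List using (List; []; _∷_; length)
open import Data.List.Relation.Unary.All using (All)
open import Data.Maybe using (Maybe; just; nothing)
open import Data.Vec using (Vec; []; _∷_)
open import Data.Product using (_×_; _,_)
open import Data.Unit using (⊤)
open import Data.Empty using (⊥)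
open import Relation.Binary.PropositionalEquality using (_≡_)

-- Basic instructions.  Register indices are 1-based in the paper; we
-- encode the register in:(suc i) as index i, likewise aux:(suc i) as i.
data Basic : Set where
  inGet  : ℕ → Basic
  outSet : Bool → Basic
  auxGet : ℕ → Basic
  auxSet : ℕ → Bool → Basic
  auxCom : ℕ → Basic

data Instr : Set where
  plain : Basic → Instr
  ptest : Basic → Instr
  ntest : Basic → Instr
  jump  : ℕ → Instr
  halt  : Instr

InstrSeq : Set
InstrSeq = List Instr

BasicNoAux : Basic → Set
BasicNoAux (inGet _)    = ⊤
BasicNoAux (outSet _)   = ⊤
BasicNoAux (auxGet _)   = ⊥
BasicNoAux (auxSet _ _) = ⊥
BasicNoAux (auxCom _)   = ⊥

InstrNoAux : Instr → Set
InstrNoAux (plain a) = BasicNoAux a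
InstrNoAux (ptest a) = BasicNoAux a
InstrNoAux (ntest a) = BasicNoAux a
InstrNoAux (jump _)  = ⊤
InstrNoAux halt      = ⊤

IS⁰ : InstrSeq → Set
IS⁰ X = All InstrNoAux X

Inputs : Set
Inputs = ℕ → Bool

record State : Set where
  constructor st
  field
    out : Bool
    aux : ℕ → Bool
open State public

update : (ℕ → Bool) → ℕ → Bool → (ℕ → Bool)
update f i b j = if i ≡ᵇ j then b else f j

exec : Basic → Inputs → State → Bool × State
exec (inGet i)    inp s = inp i , s
exec (outSet b)   inp s = b , st b (aux s)
exec (auxGet i)   inp s = aux s i , s
exec (auxSet i b) inp s = b , st (out s) (update (aux s) i b)
exec (auxCom i)   inp s = not (aux s i) , st (out s) (update (aux s) i (not (aux s i)))

reply : Basic → Inputs → State → Bool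
reply a inp s = Data.Product.proj₁ (exec a inp s)

next : Basic → Inputs → State → State
next a inp s = Data.Product.proj₂ (exec a inp s)

_!!_ : InstrSeq → ℕ → Maybe Instr
[]      !! _     = nothing
(u ∷ X) !! zero  = just u
(u ∷ X) !! suc p = X !! p

-- Positions beyond the end, and #0, have no rule: inaction.
data Halts (X : InstrSeq) (inp : Inputs) : ℕ → State → Bool → Set where
  h-halt  : ∀ {p s} → X !! p ≡ just halt → Halts X inp p s (out s)
  h-plain : ∀ {p s b a} → X !! p ≡ just (plain a) →
            Halts X inp (suc p) (next a inp s) b → Halts X inp p s b
  h-ptT   : ∀ {p s b a} → X !! p ≡ just (ptest a) → reply a inp s ≡ true →
            Halts X inp (suc p) (next a inp s) b → Halts X inp p s b
  h-ptF   : ∀ {p s b a} → X !! p ≡ just (ptest a) → reply a inp s ≡ false →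
            Halts X inp (suc (suc p)) (next a inp s) b → Halts X inp p s b
  h-ntF   : ∀ {p s b a} → X !! p ≡ just (ntest a) → reply a inp s ≡ false →
            Halts X inp (suc p) (next a inp s) b → Halts X inp p s b
  h-ntT   : ∀ {p s b a} → X !! p ≡ just (ntest a) → reply a inp s ≡ true →
            Halts X inp (suc (suc p)) (next a inp s) b → Halts X inp p s b
  h-jump  : ∀ {p s b l} → X !! p ≡ just (jump (suc l)) →
            Halts X inp (p + suc l) s b → Halts X inp p s b

toInputs : ∀ {n} → Vec Bool n → Inputs
toInputs []       _       = false
toInputs (b ∷ bs) zero    = b
toInputs (b ∷ bs) (suc i) = toInputs bs i

init : State
init = st false (λ _ → false)

Computes : (n : ℕ) → (Vec Bool n → Bool) → InstrSeq → Set
Computes n f X = (bs : Vec Bool n) → Halts X (toInputs bs) 0 init (f bs)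

PAR₂ : Vec Bool 2 → Bool
PAR₂ (false ∷ false ∷ []) = false
PAR₂ (false ∷ true  ∷ []) = true
PAR₂ (true  ∷ false ∷ []) = true
PAR₂ (true  ∷ true  ∷ []) = false

module Submission where

-- Execution is deterministic and only ever moves forward, so
-- the relational semantics 'Halts' can be replaced by an interpreter
-- 'run' defined by structural recursion on the instruction sequence; every
-- terminating execution is reproduced by 'run' ('halts⇒run').  Without
-- auxiliary registers the state that matters is the output register, and
-- only the inputs in:1, in:2 are non-constant.  Hence on sequences of
-- length ≤ 5 every instruction can be replaced by one of fourteen
-- canonical instructions with the same effect ('norm', 'simulate'); jumps
-- of length ≥ 5 leave the sequence and become #0.  Finally an exhaustive
-- evaluation of all canonical sequences of length ≤ 5 shows that none of
-- them computes PAR₂ ('no-short-parity'), which gives the theorem.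

open import Defs
open import Data.Nat using (_≤_)
open import Data.List using (length)

open import Data.Bool using (Bool; true; false; not; _∧_; if_then_else_; T)
open import Data.Bool.Properties using (T-not-≡) renaming (_≟_ to _≟ᵇ_)
open import Data.Empty using (⊥-elim)
open import Data.Fin using (Fin; #_)
open import Data.List using (List; []; _∷_; map; lookup; cartesianProductWith)
open import Data.List.Properties using (length-map)
open import Data.List.Membership.Propositional using (_∈_)
open import Data.List.Membership.Propositional.Properties using (∈-lookup; ∈-cartesianProductWith⁺)
open import Data.List.Relation.Unary.All as All using (All; []; _∷_)
open import Data.List.Relation.Unary.All.Properties using (all⁺; map⁺)
open import Data.List.Relation.Unary.Any using (here)
open import Data.Maybe using (Maybe; just; nothing)
open import Data.Maybe.Properties using (≡-dec)
open import Data.Nat using (ℕ; zero; suc; _+_; s≤s)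
open import Data.Nat.Properties using (+-suc; +-comm; ≤-pred; ≤-trans; n≤1+n; m≤n⇒m≤n+o; _≤?_; ≰⇒>)
open import Data.Product using (∃; _,_)
open import Data.Sum using (_⊎_; inj₁; inj₂)
open import Data.Vec using ([]; _∷_)
open import Function.Bundles using (Equivalence)
open import Relation.Nullary.Decidable using (isYes; yes; no)
open import Relation.Binary.PropositionalEquality using (_≡_; refl; sym; trans; cong; subst)

-- What executing one instruction does: terminate with the given output,
-- fall into inaction, or skip d further instructions and continue in a
-- new state.
data Effect : Set where
  terminate : Bool → Effect
  inaction  : Effect
  proceed   : ℕ → State → Effect

module Interpreter (inp : Inputs) where

  effect : Instr → State → Effect
  effect (plain a)      s = proceed 0 (next a inp s)
  effect (ptest a)      s = proceed (if reply a inp s then 0 else 1) (next a inp s)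
  effect (ntest a)      s = proceed (if reply a inp s then 1 else 0) (next a inp s)
  effect (jump zero)    s = inaction
  effect (jump (suc l)) s = proceed l s
  effect halt           s = terminate (out s)

  -- Since
  -- control only moves forward, recursion on the sequence suffices:
  -- 'resume X q e' continues in X after an instruction q positions before
  -- the start of X had effect e.
  mutual
    run : InstrSeq → ℕ → State → Maybe Bool
    run []      p       s = nothing
    run (u ∷ X) zero    s = resume X 0 (effect u s)
    run (u ∷ X) (suc p) s = run X p s

    resume : InstrSeq → ℕ → Effect → Maybe Bool
    resume X q (terminate b) = just b
    resume X q inaction      = nothing
    resume X q (proceed d s) = run X (d + q) s

  run-beyond : ∀ X p {s} → length X ≤ p → run X p s ≡ nothing
  run-beyond []      p       _  = refl
  run-beyond (u ∷ X) (suc p) le = run-beyond X p (≤-pred le)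

  resume-shift : ∀ X u q e → resume X q e ≡ resume (u ∷ X) (suc q) e
  resume-shift X u q (terminate b) = refl
  resume-shift X u q inaction      = refl
  resume-shift X u q (proceed d s) rewrite +-suc d q = refl

  run-at : ∀ X p {u s} → X !! p ≡ just u → run X p s ≡ resume X (suc p) (effect u s)
  run-at (v ∷ X) zero    {s = s} refl = resume-shift X v 0 (effect v s)
  run-at (v ∷ X) (suc p) {u} {s} e    = trans (run-at X p e) (resume-shift X v (suc p) (effect u s))

  run-proceed : ∀ X p {u s d s′ b} → X !! p ≡ just u → effect u s ≡ proceed d s′ →
                run X (d + suc p) s′ ≡ just b → run X p s ≡ just b
  run-proceed X p e eff h = trans (run-at X p e) (trans (cong (resume X (suc p)) eff) h)

  ptest-effect : ∀ a s {c} → reply a inp s ≡ c → effect (ptest a) s ≡ proceed (if c then 0 else 1) (next a inp s)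
  ptest-effect a s refl = refl

  ntest-effect : ∀ a s {c} → reply a inp s ≡ c → effect (ntest a) s ≡ proceed (if c then 1 else 0) (next a inp s)
  ntest-effect a s refl = refl

  halts⇒run : ∀ {X p s b} → Halts X inp p s b → run X p s ≡ just b
  halts⇒run {X} {p} (h-halt e)    = run-at X p e
  halts⇒run {X} {p} (h-plain e h) = run-proceed X p e refl (halts⇒run h)
  halts⇒run {X} {p} {s} (h-ptT {a = a} e r h) = run-proceed X p e (ptest-effect a s r) (halts⇒run h)
  halts⇒run {X} {p} {s} (h-ptF {a = a} e r h) = run-proceed X p e (ptest-effect a s r) (halts⇒run h)
  halts⇒run {X} {p} {s} (h-ntF {a = a} e r h) = run-proceed X p e (ntest-effect a s r) (halts⇒run h)
  halts⇒run {X} {p} {s} (h-ntT {a = a} e r h) = run-proceed X p e (ntest-effect a s r) (halts⇒run h)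
  halts⇒run {X} {p} {s} {b} (h-jump {l = l} e h) =
    run-proceed X p e refl (subst (λ q → run X q s ≡ just b) (trans (+-comm p (suc l)) (sym (+-suc l p))) (halts⇒run h))

inputs : Bool → Bool → Inputs
inputs x y = toInputs (x ∷ y ∷ [])

-- Normalisation of instructions without auxiliary registers: in:i.get is
-- a no-op, tests of in:i for i ≥ 3 always reply F, a test whose reply is
-- fixed is a plain instruction, and jumps of length ≥ 5 become #0.
norm : Instr → Instr
norm (plain (inGet _))                      = jump 1
norm (ptest (inGet (suc (suc _))))          = jump 2
norm (ntest (inGet (suc (suc _))))          = jump 1
norm (ptest (outSet true))                  = plain (outSet true)
norm (ntest (outSet false))                 = plain (outSet false)
norm (jump (suc (suc (suc (suc (suc _)))))) = jump 0
norm u                                      = u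

canonical : List Instr
canonical = halt ∷ jump 0 ∷ jump 1 ∷ jump 2 ∷ jump 3 ∷ jump 4
          ∷ plain (outSet false) ∷ plain (outSet true)
          ∷ ptest (outSet false) ∷ ntest (outSet true)
          ∷ ptest (inGet 0) ∷ ptest (inGet 1) ∷ ntest (inGet 0) ∷ ntest (inGet 1) ∷ []

canonical-at : (i : Fin 14) → lookup canonical i ∈ canonical
canonical-at = ∈-lookup

norm-canonical : ∀ u → InstrNoAux u → norm u ∈ canonical
norm-canonical halt                                     _ = canonical-at (# 0)
norm-canonical (jump 0)                                 _ = canonical-at (# 1)
norm-canonical (jump 1)                                 _ = canonical-at (# 2)
norm-canonical (jump 2)                                 _ = canonical-at (# 3)
norm-canonical (jump 3)                                 _ = canonical-at (# 4)
norm-canonical (jump 4)                                 _ = canonical-at (# 5)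
norm-canonical (jump (suc (suc (suc (suc (suc _))))))   _ = canonical-at (# 1)
norm-canonical (plain (inGet _))                        _ = canonical-at (# 2)
norm-canonical (plain (outSet false))                   _ = canonical-at (# 6)
norm-canonical (plain (outSet true))                    _ = canonical-at (# 7)
norm-canonical (ptest (inGet 0))                        _ = canonical-at (# 10)
norm-canonical (ptest (inGet 1))                        _ = canonical-at (# 11)
norm-canonical (ptest (inGet (suc (suc _))))            _ = canonical-at (# 3)
norm-canonical (ptest (outSet false))                   _ = canonical-at (# 8)
norm-canonical (ptest (outSet true))                    _ = canonical-at (# 7)
norm-canonical (ntest (inGet 0))                        _ = canonical-at (# 12)
norm-canonical (ntest (inGet 1))                        _ = canonical-at (# 13)
norm-canonical (ntest (inGet (suc (suc _))))            _ = canonical-at (# 2)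
norm-canonical (ntest (outSet false))                   _ = canonical-at (# 6)
norm-canonical (ntest (outSet true))                    _ = canonical-at (# 9)

-- Jumps that leave every sequence of length ≤ 5.
LongJump : Instr → Set
LongJump u = ∃ λ l → u ≡ jump (5 + l)

module _ (x y : Bool) where
  open Interpreter (inputs x y)

  norm-effect : ∀ u → InstrNoAux u → ∀ s → effect (norm u) s ≡ effect u s ⊎ LongJump u
  norm-effect halt                                   _ s = inj₁ refl
  norm-effect (jump 0)                               _ s = inj₁ refl
  norm-effect (jump 1)                               _ s = inj₁ refl
  norm-effect (jump 2)                               _ s = inj₁ refl
  norm-effect (jump 3)                               _ s = inj₁ refl
  norm-effect (jump 4)                               _ s = inj₁ refl
  norm-effect (jump (suc (suc (suc (suc (suc l)))))) _ s = inj₂ (l , refl)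
  norm-effect (plain (inGet _))                      _ s = inj₁ refl
  norm-effect (plain (outSet _))                     _ s = inj₁ refl
  norm-effect (ptest (inGet 0))                      _ s = inj₁ refl
  norm-effect (ptest (inGet 1))                      _ s = inj₁ refl
  norm-effect (ptest (inGet (suc (suc _))))          _ s = inj₁ refl
  norm-effect (ptest (outSet false))                 _ s = inj₁ refl
  norm-effect (ptest (outSet true))                  _ s = inj₁ refl
  norm-effect (ntest (inGet 0))                      _ s = inj₁ refl
  norm-effect (ntest (inGet 1))                      _ s = inj₁ refl
  norm-effect (ntest (inGet (suc (suc _))))          _ s = inj₁ refl
  norm-effect (ntest (outSet false))                 _ s = inj₁ refl
  norm-effect (ntest (outSet true))                  _ s = inj₁ refl

  -- On sequences of length ≤ 5 normalisation does not change the outcome: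
  -- a long jump leaves the sequence, exactly like #0.
  simulate : ∀ X → IS⁰ X → length X ≤ 5 → ∀ p s → run (map norm X) p s ≡ run X p s
  simulate []      _         _   p       s = refl
  simulate (u ∷ X) (_ ∷ ok)  len (suc p) s = simulate X ok (≤-trans (n≤1+n _) len) p s
  simulate (u ∷ X) (nu ∷ ok) len zero    s with norm-effect u nu s
  ... | inj₁ same = trans (cong (resume (map norm X) 0) same) (resume-sim (effect u s))
    where
    resume-sim : ∀ e → resume (map norm X) 0 e ≡ resume X 0 e
    resume-sim (terminate b)  = refl
    resume-sim inaction       = refl
    resume-sim (proceed d s′) = simulate X ok (≤-trans (n≤1+n _) len) (d + 0) s′
  ... | inj₂ (l , refl) = sym (run-beyond X (4 + l + 0) (m≤n⇒m≤n+o 0 (m≤n⇒m≤n+o l (≤-pred len))))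

  correctOn : InstrSeq → Bool
  correctOn X = isYes (≡-dec _≟ᵇ_ (run X 0 init) (just (PAR₂ (x ∷ y ∷ []))))

open Interpreter using (run; halts⇒run)

computesParity? : InstrSeq → Bool
computesParity? X = correctOn false false X ∧ correctOn false true X ∧ correctOn true false X ∧ correctOn true true X

computesParity?-complete : ∀ X → (∀ x y → run (inputs x y) X 0 init ≡ just (PAR₂ (x ∷ y ∷ []))) →
                           T (computesParity? X)
computesParity?-complete X h rewrite h false false | h false true | h true false | h true true = _

programs : ℕ → List InstrSeq
programs zero    = [] ∷ []
programs (suc n) = cartesianProductWith _∷_ canonical (programs n)

programs-complete : ∀ P → All (_∈ canonical) P → P ∈ programs (length P)
programs-complete []      []        = here refl
programs-complete (u ∷ P) (u∈ ∷ P∈) = ∈-cartesianProductWith⁺ _∷_ u∈ (programs-complete P P∈)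

no-short-parity : ∀ n → n ≤ 5 → All (λ P → T (not (computesParity? P))) (programs n)
no-short-parity 0 _ = all⁺ _ (programs 0) _
no-short-parity 1 _ = all⁺ _ (programs 1) _
no-short-parity 2 _ = all⁺ _ (programs 2) _
no-short-parity 3 _ = all⁺ _ (programs 3) _
no-short-parity 4 _ = all⁺ _ (programs 4) _
no-short-parity 5 _ = all⁺ _ (programs 5) _
no-short-parity (suc (suc (suc (suc (suc (suc _)))))) (s≤s (s≤s (s≤s (s≤s (s≤s ())))))

-- If X ∈ IS⁰ computes PAR₂ but had length ≤ 5, its normalisation would be
-- a canonical sequence of length ≤ 5 computing PAR₂.
lemma1 : (X : InstrSeq) → IS⁰ X → Computes 2 PAR₂ X → 6 ≤ length X
lemma1 X noAux computes with 6 ≤? length X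
... | yes long = long
... | no ¬long = ⊥-elim (subst T (Equivalence.to T-not-≡ rejected) accepted)
  where
  short : length X ≤ 5
  short = ≤-pred (≰⇒> ¬long)

  P : InstrSeq
  P = map norm X

  accepted : T (computesParity? P)
  accepted = computesParity?-complete P λ x y →
    trans (simulate x y X noAux short 0 init) (halts⇒run (inputs x y) (computes (x ∷ y ∷ [])))

  rejected : T (not (computesParity? P))
  rejected = All.lookup (no-short-parity (length P) (subst (_≤ 5) (sym (length-map norm X)) short))
                        (programs-complete P (map⁺ (All.map (λ {u} → norm-canonical u) noAux)))
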